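{- Let $G=(V,E)$ be a graph with $n$ vertices and nonnegative edge lengths $c_e$, let $r\in V$ be a root and let $k$ be an integer with $0\le k\le n-1$. Define the weights $\phi(r)=n^2$ and $\phi(v)=1$ for all $v\in V\setminus\{r\}$, and let $S=(n^2+k)^2$. Then the rooted $k$-MST instance $(G,c,r,k)$ is equivalent to the $S$-MPCSF instance $(G,c,\phi,S)$: every tree containing $r$ and at least $k$ other vertices yields a forest of the same cost collecting prize at least $S$, and for every forest collecting prize at least $S$, its connected component containing $r$ is a tree containing $r$ and at least $k$ other vertices. In particular the optimal values of the two instances coincide.
   Context: Rooted $k$-MST: given a graph with nonnegative edge lengths, a root $r$ and an integer $k$, find a minimum-cost tree containing $r$ and at least $k$ vertices other than $r$ (cost is the sum of edge lengths). $S$-MPCSF on a graph: given nonnegative vertex weights $\phi$ and a number $S$, find a minimum-cost forest $F\subseteq E$ whose collected prize $\sum\phi(u)\phi(v)$, summed over all ordered pairs $(u,v)\in V\times V$ with $u=v$ or $u,v$ in the same connected component of $F$, is at least $S$.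
   Formalization: The edge lengths $c_e$ are nonnegative rationals. -}

module Defs where

open import Data.Nat using (ℕ; zero; suc; _+_; _*_; _^_)
open import Data.Bool using (Bool; true; false; _∧_; _∨_; not; if_then_else_)
open import Data.Fin using (Fin; zero; suc)
open import Data.Fin.Properties using (_≟_)
open import Data.Product using (_×_; proj₁; proj₂)
open import Relation.Nullary.Decidable using (isYes)
open import Data.Rational using (ℚ; 0ℚ) renaming (_+_ to _+ℚ_)
open import Relation.Binary.PropositionalEquality using (_≡_)

-- A (multi)graph on vertex set Fin n with m edges; edge e joins
-- proj₁ (ends e) and proj₂ (ends e).  Edge subsets are Fin m → Bool.

anyF : ∀ {m} → (Fin m → Bool) → Bool
anyF {zero} f = false
anyF {suc m} f = f zero ∨ anyF (λ i → f (suc i))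

countF : ∀ {m} → (Fin m → Bool) → ℕ
countF {zero} f = 0
countF {suc m} f = (if f zero then 1 else 0) + countF (λ i → f (suc i))

sumℕ : ∀ {m} → (Fin m → ℕ) → ℕ
sumℕ {zero} f = 0
sumℕ {suc m} f = f zero + sumℕ (λ i → f (suc i))

sumℚ : ∀ {m} → (Fin m → ℚ) → ℚ
sumℚ {zero} f = 0ℚ
sumℚ {suc m} f = f zero +ℚ sumℚ (λ i → f (suc i))

_==_ : ∀ {n} → Fin n → Fin n → Bool
u == v = isYes (u ≟ v)

reach : ∀ {n m} → (Fin m → Fin n × Fin n) → (Fin m → Bool) → ℕ → Fin n → Fin n → Bool
reach ends F zero u v = u == v
reach ends F (suc t) u v = reach ends F t u v ∨ anyF (λ e → F e ∧
  ((reach ends F t u (proj₁ (ends e)) ∧ (proj₂ (ends e) == v)) ∨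
   (reach ends F t u (proj₂ (ends e)) ∧ (proj₁ (ends e) == v))))

-- u and v lie in the same connected component of (Fin n, F)
-- (a walk of at most n edges suffices on n vertices)
connected : ∀ {n m} → (Fin m → Fin n × Fin n) → (Fin m → Bool) → Fin n → Fin n → Bool
connected {n} ends F u v = reach ends F n u v

remove : ∀ {m} → (Fin m → Bool) → Fin m → (Fin m → Bool)
remove F e f = F f ∧ not (f == e)

-- F is a forest: no edge of F lies on a cycle of F, i.e. the endpoints of every
-- edge e ∈ F are disconnected in F ∖ {e} (this also excludes loops).
IsForest : ∀ {n m} → (Fin m → Fin n × Fin n) → (Fin m → Bool) → Set
IsForest ends F = ∀ e → F e ≡ true →
  connected ends (remove F e) (proj₁ (ends e)) (proj₂ (ends e)) ≡ false

-- T (edge set) is a tree containing r: acyclic, and every edge of T lies in the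
-- component of r.  Its vertex set is {v | connected T r v} (so {r} if T = ∅).
IsRootedTree : ∀ {n m} → (Fin m → Fin n × Fin n) → Fin n → (Fin m → Bool) → Set
IsRootedTree ends r T = IsForest ends T ×
  (∀ e → T e ≡ true → connected ends T r (proj₁ (ends e)) ≡ true)

othersIn : ∀ {n m} → (Fin m → Fin n × Fin n) → Fin n → (Fin m → Bool) → ℕ
othersIn ends r T = countF (λ v → not (v == r) ∧ connected ends T r v)

cost : ∀ {m} → (Fin m → ℚ) → (Fin m → Bool) → ℚ
cost c F = sumℚ (λ e → if F e then c e else 0ℚ)

prize : ∀ {n m} → (Fin m → Fin n × Fin n) → (Fin n → ℕ) → (Fin m → Bool) → ℕ
prize ends φ F = sumℕ (λ u → sumℕ (λ v →
  if (u == v) ∨ connected ends F u v then φ u * φ v else 0))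

φred : (n : ℕ) → Fin n → Fin n → ℕ
φred n r v = if v == r then n ^ 2 else 1

compOf : ∀ {n m} → (Fin m → Fin n × Fin n) → Fin n → (Fin m → Bool) → (Fin m → Bool)
compOf ends r F e = F e ∧ connected ends F r (proj₁ (ends e))

module Submission where

-- For an edge set F let C be the vertex set of the component of r, a the
-- number of vertices of C other than r, and N = n².  A pair (u , v) inside C
-- is always collected and a pair split by C never is, so
--   (N + a)² = (Σ_C φ)² ≤ prize F ≤ (Σ_C φ)² + (Σ_{V∖C} φ)² ≤ (N + a)² + N.
-- The lower bound turns a rooted tree with k ≤ a into a forest (itself) of
-- the same cost collecting prize ≥ S.  The upper bound shows that prize ≥ S
-- forces k ≤ a, since (N + a + 1)² > (N + a)² + N; the edges of the component
-- of r then form a rooted tree with at least a other vertices, and it costs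
-- no more than F because lengths are nonnegative.

open import Defs
open import Data.Nat using (ℕ; zero; suc; _∸_; _^_; _+_; _*_; z≤n; s≤s)
  renaming (_≤_ to _≤ℕ_; _<_ to _<ℕ_)
import Data.Nat.Properties as NP
open import Data.Nat.Tactic.RingSolver using (solve-∀)
open import Data.Fin using (Fin; zero; suc)
open import Data.Fin.Properties using (_≟_; suc-injective; all?; ¬∀⟶∃¬)
open import Data.Bool using (Bool; true; false; _∧_; _∨_; not; if_then_else_)
import Data.Bool.Properties as BP
open import Data.Product using (_×_; Σ; _,_; proj₁; proj₂)
open import Data.Sum using (_⊎_; inj₁; inj₂)
open import Data.Empty using (⊥-elim)
open import Relation.Nullary using (yes; no; ¬_)
open import Relation.Nullary.Decidable using (isYes≗does; dec-true; dec-false; toWitness)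
open import Relation.Binary.PropositionalEquality
  using (_≡_; refl; sym; trans; cong; cong₂; subst; module ≡-Reasoning)
open import Data.Rational using (ℚ; 0ℚ; _≤_)
import Data.Rational.Properties as QP
open import Function.Bundles using (_⇔_; mk⇔; Equivalence)

∨-inl : ∀ {a b} → a ≡ true → (a ∨ b) ≡ true
∨-inl refl = refl

∨-inr : ∀ {a b} → b ≡ true → (a ∨ b) ≡ true
∨-inr {a} refl = BP.∨-zeroʳ a

∨-cases : ∀ {a b} → (a ∨ b) ≡ true → a ≡ true ⊎ b ≡ true
∨-cases {true} _ = inj₁ refl
∨-cases {false} p = inj₂ p

∧-pair : ∀ {a b} → a ≡ true → b ≡ true → (a ∧ b) ≡ true
∧-pair refl refl = refl

∧-split : ∀ {a b} → (a ∧ b) ≡ true → a ≡ true × b ≡ true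
∧-split {true} {true} _ = refl , refl

≡-from-⇔ : ∀ {a b} → (a ≡ true → b ≡ true) → (b ≡ true → a ≡ true) → a ≡ b
≡-from-⇔ {false} {false} _ _ = refl
≡-from-⇔ {false} {true} _ b⇒a = b⇒a refl
≡-from-⇔ {true} a⇒b _ = sym (a⇒b refl)

false-antimono : ∀ {a b} → (a ≡ true → b ≡ true) → b ≡ false → a ≡ false
false-antimono {false} _ _ = refl
false-antimono {true} a⇒b b≡false = subst (_≡ false) (a⇒b refl) b≡false

strict-step : ∀ {a b} → (a ≡ true → b ≡ true) → ¬ b ≡ a → a ≡ false × b ≡ true
strict-step {false} {false} _ differ = ⊥-elim (differ refl)
strict-step {false} {true} _ _ = refl , refl
strict-step {true} a⇒b differ = ⊥-elim (differ (a⇒b refl))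

==-refl : ∀ {n} (u : Fin n) → (u == u) ≡ true
==-refl u = trans (isYes≗does (u ≟ u)) (dec-true (u ≟ u) refl)

==-sound : ∀ {n} {u v : Fin n} → (u == v) ≡ true → u ≡ v
==-sound p = toWitness (Equivalence.from BP.T-≡ p)

==-false : ∀ {n} {u v : Fin n} → ¬ u ≡ v → (u == v) ≡ false
==-false {u = u} {v} u≢v = trans (isYes≗does (u ≟ v)) (dec-false (u ≟ v) u≢v)

==-suc : ∀ {n} (i r : Fin n) → (suc i == suc r) ≡ (i == r)
==-suc i r = ≡-from-⇔
  (λ p → subst (λ z → (i == z) ≡ true) (suc-injective (==-sound p)) (==-refl i))
  (λ p → subst (λ z → (suc i == suc z) ≡ true) (==-sound p) (==-refl (suc i)))

anyF-intro : ∀ {m} (f : Fin m → Bool) i → f i ≡ true → anyF f ≡ true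
anyF-intro f zero p = ∨-inl p
anyF-intro f (suc i) p = ∨-inr (anyF-intro (λ j → f (suc j)) i p)

anyF-elim : ∀ {m} (f : Fin m → Bool) → anyF f ≡ true → Σ (Fin m) λ i → f i ≡ true
anyF-elim {suc m} f p with ∨-cases {f zero} p
... | inj₁ q = zero , q
... | inj₂ q with anyF-elim (λ j → f (suc j)) q
... | i , fi = suc i , fi

anyF-cong : ∀ {m} (f g : Fin m → Bool) → (∀ i → f i ≡ g i) → anyF f ≡ anyF g
anyF-cong {zero} f g f≗g = refl
anyF-cong {suc m} f g f≗g =
  cong₂ _∨_ (f≗g zero) (anyF-cong (λ j → f (suc j)) (λ j → g (suc j)) (λ j → f≗g (suc j)))

_⊆_ : ∀ {m} → (Fin m → Bool) → (Fin m → Bool) → Set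
f ⊆ g = ∀ i → f i ≡ true → g i ≡ true

indicator : Bool → ℕ
indicator b = if b then 1 else 0

indicator-mono : ∀ a b → (a ≡ true → b ≡ true) → indicator a ≤ℕ indicator b
indicator-mono false b _ = z≤n
indicator-mono true b a⇒b rewrite a⇒b refl = NP.≤-refl

countF-mono : ∀ {m} (f g : Fin m → Bool) → f ⊆ g → countF f ≤ℕ countF g
countF-mono {zero} f g f⊆g = z≤n
countF-mono {suc m} f g f⊆g = NP.+-mono-≤ (indicator-mono (f zero) (g zero) (f⊆g zero))
  (countF-mono (λ j → f (suc j)) (λ j → g (suc j)) (λ j → f⊆g (suc j)))

countF-strict : ∀ {m} (f g : Fin m → Bool) → f ⊆ g → ∀ j → f j ≡ false → g j ≡ true
  → suc (countF f) ≤ℕ countF g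
countF-strict {suc m} f g f⊆g zero fj gj rewrite fj | gj =
  s≤s (countF-mono (λ j → f (suc j)) (λ j → g (suc j)) (λ j → f⊆g (suc j)))
countF-strict {suc m} f g f⊆g (suc j) fj gj =
  subst (_≤ℕ countF g) (NP.+-suc (indicator (f zero)) _)
    (NP.+-mono-≤ (indicator-mono (f zero) (g zero) (f⊆g zero))
      (countF-strict (λ j → f (suc j)) (λ j → g (suc j)) (λ j → f⊆g (suc j)) j fj gj))

countF-bound : ∀ {m} (f : Fin m → Bool) → countF f ≤ℕ m
countF-bound {zero} f = z≤n
countF-bound {suc m} f = NP.+-mono-≤ (indicator-mono (f zero) true (λ _ → refl)) (countF-bound (λ j → f (suc j)))

sumℕ-cong : ∀ {m} (f g : Fin m → ℕ) → (∀ i → f i ≡ g i) → sumℕ f ≡ sumℕ g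
sumℕ-cong {zero} f g f≗g = refl
sumℕ-cong {suc m} f g f≗g = cong₂ _+_ (f≗g zero) (sumℕ-cong (λ j → f (suc j)) (λ j → g (suc j)) (λ j → f≗g (suc j)))

sumℕ-mono : ∀ {m} (f g : Fin m → ℕ) → (∀ i → f i ≤ℕ g i) → sumℕ f ≤ℕ sumℕ g
sumℕ-mono {zero} f g f≤g = z≤n
sumℕ-mono {suc m} f g f≤g = NP.+-mono-≤ (f≤g zero) (sumℕ-mono (λ j → f (suc j)) (λ j → g (suc j)) (λ j → f≤g (suc j)))

sumℕ-+ : ∀ {m} (f g : Fin m → ℕ) → sumℕ (λ i → f i + g i) ≡ sumℕ f + sumℕ g
sumℕ-+ {zero} f g = refl
sumℕ-+ {suc m} f g rewrite sumℕ-+ (λ j → f (suc j)) (λ j → g (suc j)) =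
  middle-swap (f zero) (g zero) (sumℕ (λ j → f (suc j))) (sumℕ (λ j → g (suc j)))
  where
  middle-swap : ∀ a b c d → a + b + (c + d) ≡ a + c + (b + d)
  middle-swap = solve-∀

sumℕ-*ˡ : ∀ {m} (f : Fin m → ℕ) a → sumℕ (λ i → a * f i) ≡ a * sumℕ f
sumℕ-*ˡ {zero} f a = sym (NP.*-zeroʳ a)
sumℕ-*ˡ {suc m} f a rewrite sumℕ-*ˡ (λ j → f (suc j)) a = sym (NP.*-distribˡ-+ a (f zero) _)

sumℕ-*ʳ : ∀ {m} (f : Fin m → ℕ) a → sumℕ (λ i → f i * a) ≡ sumℕ f * a
sumℕ-*ʳ {zero} f a = refl
sumℕ-*ʳ {suc m} f a rewrite sumℕ-*ʳ (λ j → f (suc j)) a = sym (NP.*-distribʳ-+ a (f zero) _)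

sumℕ-square : ∀ {m} (g : Fin m → ℕ) → sumℕ (λ u → sumℕ (λ v → g u * g v)) ≡ sumℕ g * sumℕ g
sumℕ-square g = trans (sumℕ-cong _ _ (λ u → sumℕ-*ˡ g (g u))) (sumℕ-*ʳ g (sumℕ g))

sumℕ-point : ∀ {m} (f : Fin m → ℕ) r → sumℕ f ≡ f r + sumℕ (λ u → if u == r then 0 else f u)
sumℕ-point {suc m} f zero = refl
sumℕ-point {suc m} f (suc r) = begin
  f zero + sumℕ (λ i → f (suc i))
    ≡⟨ cong (f zero +_) (sumℕ-point (λ i → f (suc i)) r) ⟩
  f zero + (f (suc r) + sumℕ (λ i → if i == r then 0 else f (suc i)))
    ≡⟨ exchange (f zero) (f (suc r)) _ ⟩
  f (suc r) + (f zero + sumℕ (λ i → if i == r then 0 else f (suc i)))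
    ≡⟨ cong (λ s → f (suc r) + (f zero + s))
         (sumℕ-cong _ _ λ i → cong (λ b → if b then 0 else f (suc i)) (sym (==-suc i r))) ⟩
  f (suc r) + (f zero + sumℕ (λ i → if suc i == suc r then 0 else f (suc i)))
    ∎
  where
  open ≡-Reasoning
  exchange : ∀ a b c → a + (b + c) ≡ b + (a + c)
  exchange = solve-∀

sumℕ-indicator : ∀ {m} (b : Fin m → Bool) → sumℕ (λ u → indicator (b u)) ≡ countF b
sumℕ-indicator {zero} b = refl
sumℕ-indicator {suc m} b = cong (indicator (b zero) +_) (sumℕ-indicator (λ j → b (suc j)))

module Walks {n m : ℕ} (ends : Fin m → Fin n × Fin n) where

  Joins : Fin m → Fin n → Fin n → Set
  Joins e w v = (proj₁ (ends e) ≡ w × proj₂ (ends e) ≡ v) ⊎ (proj₂ (ends e) ≡ w × proj₁ (ends e) ≡ v)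

  joins-sym : ∀ {e w v} → Joins e w v → Joins e v w
  joins-sym (inj₁ (p , q)) = inj₂ (q , p)
  joins-sym (inj₂ (p , q)) = inj₁ (q , p)

  LastEdge : (Fin m → Bool) → ℕ → Fin n → Fin n → Set
  LastEdge F t u v = Σ (Fin m) λ e → Σ (Fin n) λ w →
    F e ≡ true × reach ends F t u w ≡ true × Joins e w v

  reach-suc : ∀ {F t u v} → reach ends F t u v ≡ true → reach ends F (suc t) u v ≡ true
  reach-suc = ∨-inl

  reach-extend : ∀ {F t u w v e} → F e ≡ true → reach ends F t u w ≡ true → Joins e w v
    → reach ends F (suc t) u v ≡ true
  reach-extend {F} {t} {u} {e = e} Fe p (inj₁ (refl , refl)) =
    ∨-inr {reach ends F t u _} (anyF-intro _ e (∧-pair Fe (∨-inl (∧-pair p (==-refl _)))))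
  reach-extend {F} {t} {u} {e = e} Fe p (inj₂ (refl , refl)) =
    ∨-inr {reach ends F t u _} (anyF-intro _ e (∧-pair Fe (∨-inr (∧-pair p (==-refl _)))))

  reach-last : ∀ F t u v → reach ends F (suc t) u v ≡ true
    → reach ends F t u v ≡ true ⊎ LastEdge F t u v
  reach-last F t u v p with ∨-cases {reach ends F t u v} p
  ... | inj₁ shorter = inj₁ shorter
  ... | inj₂ some-edge with anyF-elim _ some-edge
  ... | e , q with ∧-split {F e} q
  ... | Fe , q′ with ∨-cases q′
  ... | inj₁ forward = let (p₁ , e₂≡v) = ∧-split forward in
    inj₂ (e , _ , Fe , p₁ , inj₁ (refl , ==-sound e₂≡v))
  ... | inj₂ backward = let (p₂ , e₁≡v) = ∧-split backward in
    inj₂ (e , _ , Fe , p₂ , inj₂ (refl , ==-sound e₁≡v))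

  reach-pad : ∀ {F t u v} d → reach ends F t u v ≡ true → reach ends F (d + t) u v ≡ true
  reach-pad zero p = p
  reach-pad {F} {t} {u} (suc d) p = reach-suc {F} {d + t} {u} (reach-pad d p)

  reach-++ : ∀ {F s} t {u w v} → reach ends F s u w ≡ true → reach ends F t w v ≡ true
    → reach ends F (t + s) u v ≡ true
  reach-++ {F} {s} zero {u} p q = subst (λ z → reach ends F s u z ≡ true) (==-sound q) p
  reach-++ {F} {s} (suc t) {u} {w} {v} p q with reach-last F t w v q
  ... | inj₁ shorter = reach-suc {F} {t + s} {u} (reach-++ t p shorter)
  ... | inj₂ (_ , _ , Fe , q′ , joins) = reach-extend {F} {t + s} {u} Fe (reach-++ t p q′) joins

  reach-sym : ∀ {F} t {u v} → reach ends F t u v ≡ true → reach ends F t v u ≡ true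
  reach-sym zero {u} p = subst (λ z → (z == u) ≡ true) (==-sound p) (==-refl u)
  reach-sym {F} (suc t) {u} {v} p with reach-last F t u v p
  ... | inj₁ shorter = reach-suc {F} {t} {v} (reach-sym t shorter)
  ... | inj₂ (_ , _ , Fe , q , joins) =
    subst (λ z → reach ends F z v u ≡ true) (NP.+-comm t 1)
      (reach-++ t (reach-extend {F} {0} {v} Fe (==-refl v) (joins-sym joins)) (reach-sym t q))

  reach-⊆ : ∀ {F G} → F ⊆ G → ∀ t {u v} → reach ends F t u v ≡ true → reach ends G t u v ≡ true
  reach-⊆ F⊆G zero p = p
  reach-⊆ {F} {G} F⊆G (suc t) {u} {v} p with reach-last F t u v p
  ... | inj₁ shorter = reach-suc {G} {t} {u} (reach-⊆ F⊆G t shorter)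
  ... | inj₂ (e , w , Fe , q , joins) = reach-extend {G} {t} {u} (F⊆G e Fe) (reach-⊆ F⊆G t q) joins

  forest-⊆ : ∀ {F G} → G ⊆ F → IsForest ends F → IsForest ends G
  forest-⊆ {F} {G} G⊆F F-forest e Ge =
    false-antimono (reach-⊆ remove-⊆ n) (F-forest e (G⊆F e Ge))
    where
    remove-⊆ : remove G e ⊆ remove F e
    remove-⊆ f p = let (Gf , f≢e) = ∧-split {G f} p in ∧-pair (G⊆F f Gf) f≢e

  module Saturation (F : Fin m → Bool) (u : Fin n) where

    Stable : ℕ → Set
    Stable t = ∀ v → reach ends F (suc t) u v ≡ reach ends F t u v

    reach-suc-cong : ∀ s t → (∀ v → reach ends F s u v ≡ reach ends F t u v)
      → ∀ v → reach ends F (suc s) u v ≡ reach ends F (suc t) u v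
    reach-suc-cong s t same v = cong₂ _∨_ (same v) (anyF-cong _ _ λ e →
      cong₂ (λ a b → F e ∧ ((a ∧ (proj₂ (ends e) == v)) ∨ (b ∧ (proj₁ (ends e) == v))))
        (same (proj₁ (ends e))) (same (proj₂ (ends e))))

    stable-from : ∀ {t} → Stable t → ∀ d v → reach ends F (d + t) u v ≡ reach ends F t u v
    stable-from st zero v = refl
    stable-from {t} st (suc d) v = trans (reach-suc-cong (d + t) t (stable-from st d) v) (st v)

    reached : ℕ → ℕ
    reached t = countF (reach ends F t u)

    grows-or-stable : ∀ t → suc t ≤ℕ reached t ⊎ Stable t
    grows-or-stable zero = inj₁ (NP.≤-trans (s≤s z≤n)
      (countF-strict (λ _ → false) (reach ends F 0 u) (λ _ ()) u refl (==-refl u)))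
    grows-or-stable (suc t) with grows-or-stable t
    ... | inj₂ stable = inj₂ (reach-suc-cong (suc t) t stable)
    ... | inj₁ grown with all? (λ v → reach ends F (suc t) u v BP.≟ reach ends F t u v)
    ...   | yes stable = inj₂ (reach-suc-cong (suc t) t stable)
    ...   | no unstable with ¬∀⟶∃¬ n _ (λ v → reach ends F (suc t) u v BP.≟ reach ends F t u v) unstable
    ...     | v , differ = let (old , new) = strict-step (reach-suc {F} {t} {u}) differ in
      inj₁ (NP.≤-trans (s≤s grown)
        (countF-strict _ _ (λ w → reach-suc {F} {t} {u} {w}) v old new))

    -- there are only n vertices, so the reachable set is stable after n steps
    stable-at-n : Stable n
    stable-at-n with grows-or-stable n
    ... | inj₁ grown = ⊥-elim (NP.<⇒≱ grown (countF-bound (reach ends F n u)))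
    ... | inj₂ stable = stable

    saturate : ∀ t {v} → reach ends F t u v ≡ true → connected ends F u v ≡ true
    saturate t {v} p with NP.≤-total t n
    ... | inj₁ t≤n = subst (λ z → reach ends F z u v ≡ true) (NP.m∸n+n≡m t≤n) (reach-pad (n ∸ t) p)
    ... | inj₂ n≤t = trans (sym (stable-from stable-at-n (t ∸ n) v))
      (subst (λ z → reach ends F z u v ≡ true) (sym (NP.m∸n+n≡m n≤t)) p)

  open Saturation using (saturate)

  module Connectivity (F : Fin m → Bool) where

    conn-refl : ∀ u → connected ends F u u ≡ true
    conn-refl u = saturate F u 0 (==-refl u)

    conn-sym : ∀ {u v} → connected ends F u v ≡ true → connected ends F v u ≡ true
    conn-sym = reach-sym n

    conn-trans : ∀ {u v w} → connected ends F u v ≡ true → connected ends F v w ≡ true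
      → connected ends F u w ≡ true
    conn-trans {u} p q = saturate F u (n + n) (reach-++ n p q)

  module Component (r : Fin n) (F : Fin m → Bool) where

    compOf-⊆ : compOf ends r F ⊆ F
    compOf-⊆ e p = proj₁ (∧-split {F e} p)

    reach-comp : ∀ t {v} → reach ends F t r v ≡ true → reach ends (compOf ends r F) t r v ≡ true
    reach-comp zero p = p
    reach-comp (suc t) {v} p with reach-last F t r v p
    ... | inj₁ shorter = reach-suc {compOf ends r F} {t} {r} (reach-comp t shorter)
    ... | inj₂ (e , w , Fe , q , joins) =
      reach-extend {compOf ends r F} {t} {r} (∧-pair Fe (tail-connected joins)) (reach-comp t q) joins
      where
      -- the first endpoint of e is w or v, and both are connected to r
      tail-connected : Joins e w v → connected ends F r (proj₁ (ends e)) ≡ true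
      tail-connected (inj₁ (refl , _)) = saturate F r t q
      tail-connected (inj₂ (_ , refl)) = saturate F r (suc t) p

    compOf-rooted : IsForest ends F → IsRootedTree ends r (compOf ends r F)
    compOf-rooted F-forest =
      forest-⊆ compOf-⊆ F-forest , λ e ce → reach-comp n (proj₂ (∧-split {F e} ce))

    compOf-others : othersIn ends r F ≤ℕ othersIn ends r (compOf ends r F)
    compOf-others = countF-mono (λ v → not (v == r) ∧ connected ends F r v)
      (λ v → not (v == r) ∧ connected ends (compOf ends r F) r v) λ v p →
      let (v≢r , r~v) = ∧-split p in ∧-pair v≢r (reach-comp n r~v)

square : ∀ x → x ^ 2 ≡ x * x
square x = cong (x *_) (NP.*-identityʳ x)

restrict : ∀ {n} → (Fin n → Bool) → (Fin n → ℕ) → Fin n → ℕ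
restrict C φ u = if C u then φ u else 0

pair-lower : ∀ cu cv b x y → (cu ≡ true → cv ≡ true → b ≡ true)
  → (if cu then x else 0) * (if cv then y else 0) ≤ℕ (if b then x * y else 0)
pair-lower true true b x y inside rewrite inside refl refl = NP.≤-refl
pair-lower true false b x y _ rewrite NP.*-zeroʳ x = z≤n
pair-lower false cv b x y _ = z≤n

pair-upper : ∀ cu cv b x y → (b ≡ true → cu ≡ cv)
  → (if b then x * y else 0)
    ≤ℕ (if cu then x else 0) * (if cv then y else 0) + (if not cu then x else 0) * (if not cv then y else 0)
pair-upper cu cv false x y _ = z≤n
pair-upper true true true x y _ = NP.m≤m+n (x * y) 0
pair-upper false false true x y _ = NP.≤-refl
pair-upper true false true x y same with same refl
... | ()
pair-upper false true true x y same with same refl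
... | ()

module Prize {n m : ℕ} (ends : Fin m → Fin n × Fin n) (φ : Fin n → ℕ) (F : Fin m → Bool) where

  linked : Fin n → Fin n → Bool
  linked u v = (u == v) ∨ connected ends F u v

  prize-lower : (C : Fin n → Bool) → (∀ u v → C u ≡ true → C v ≡ true → linked u v ≡ true)
    → sumℕ (restrict C φ) * sumℕ (restrict C φ) ≤ℕ prize ends φ F
  prize-lower C inside = subst (_≤ℕ prize ends φ F) (sumℕ-square (restrict C φ))
    (sumℕ-mono _ _ λ u → sumℕ-mono _ _ λ v →
      pair-lower (C u) (C v) (linked u v) (φ u) (φ v) (inside u v))

  prize-upper : (C : Fin n → Bool) → (∀ u v → linked u v ≡ true → C u ≡ C v)
    → prize ends φ F ≤ℕ sumℕ (restrict C φ) * sumℕ (restrict C φ)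
                       + sumℕ (restrict (λ u → not (C u)) φ) * sumℕ (restrict (λ u → not (C u)) φ)
  prize-upper C closed = begin
    prize ends φ F
      ≤⟨ sumℕ-mono _ _ (λ u → sumℕ-mono _ _ λ v →
           pair-upper (C u) (C v) (linked u v) (φ u) (φ v) (closed u v)) ⟩
    sumℕ (λ u → sumℕ (λ v → I u * I v + O u * O v))
      ≡⟨ sumℕ-cong _ _ (λ u → sumℕ-+ (λ v → I u * I v) (λ v → O u * O v)) ⟩
    sumℕ (λ u → sumℕ (λ v → I u * I v) + sumℕ (λ v → O u * O v))
      ≡⟨ sumℕ-+ (λ u → sumℕ (λ v → I u * I v)) (λ u → sumℕ (λ v → O u * O v)) ⟩
    sumℕ (λ u → sumℕ (λ v → I u * I v)) + sumℕ (λ u → sumℕ (λ v → O u * O v))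
      ≡⟨ cong₂ _+_ (sumℕ-square I) (sumℕ-square O) ⟩
    sumℕ I * sumℕ I + sumℕ O * sumℕ O ∎
    where
    open NP.≤-Reasoning
    I O : Fin n → ℕ
    I = restrict C φ
    O = restrict (λ u → not (C u)) φ

module RootedPrize {n m : ℕ} (ends : Fin m → Fin n × Fin n) (r : Fin n) (F : Fin m → Bool) where
  open Prize ends (φred n r) F
  open Walks.Connectivity ends F

  inC : Fin n → Bool
  inC = connected ends F r

  inC-linked : ∀ u v → inC u ≡ true → inC v ≡ true → linked u v ≡ true
  inC-linked u v r~u r~v = ∨-inr {u == v} (conn-trans (conn-sym r~u) r~v)

  linked⇒connected : ∀ u v → linked u v ≡ true → connected ends F u v ≡ true
  linked⇒connected u v p with ∨-cases {u == v} p
  ... | inj₁ u≡v = subst (λ z → connected ends F u z ≡ true) (==-sound u≡v) (conn-refl u)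
  ... | inj₂ u~v = u~v

  inC-closed : ∀ u v → linked u v ≡ true → inC u ≡ inC v
  inC-closed u v p =
    ≡-from-⇔ (λ r~u → conn-trans r~u u~v) (λ r~v → conn-trans r~v (conn-sym u~v))
    where
    u~v : connected ends F u v ≡ true
    u~v = linked⇒connected u v p

  weight-inside : sumℕ (restrict inC (φred n r)) ≡ n ^ 2 + othersIn ends r F
  weight-inside = begin
    sumℕ (restrict inC (φred n r))
      ≡⟨ sumℕ-point _ r ⟩
    restrict inC (φred n r) r + sumℕ (λ u → if u == r then 0 else restrict inC (φred n r) u)
      ≡⟨ cong₂ _+_ at-root (sumℕ-cong _ _ off-root) ⟩
    n ^ 2 + sumℕ (λ u → indicator (not (u == r) ∧ inC u))
      ≡⟨ cong (n ^ 2 +_) (sumℕ-indicator (λ u → not (u == r) ∧ inC u)) ⟩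
    n ^ 2 + othersIn ends r F ∎
    where
    open ≡-Reasoning
    at-root : restrict inC (φred n r) r ≡ n ^ 2
    at-root rewrite conn-refl r | ==-refl r = refl
    off-root : ∀ u → (if u == r then 0 else restrict inC (φred n r) u) ≡ indicator (not (u == r) ∧ inC u)
    off-root u with u == r | inC u
    ... | true | _ = refl
    ... | false | true = refl
    ... | false | false = refl

  weight-outside : sumℕ (restrict (λ u → not (inC u)) (φred n r)) ≤ℕ n
  weight-outside = subst (_≤ℕ n) (sym (trans (sumℕ-cong _ _ unit-weight) (sumℕ-indicator (λ u → not (inC u)))))
    (countF-bound (λ u → not (inC u)))
    where
    not-root : ∀ u → inC u ≡ false → ¬ u ≡ r
    not-root u outside refl with trans (sym (conn-refl r)) outside
    ... | ()
    unit-weight : ∀ u → restrict (λ u → not (inC u)) (φred n r) u ≡ indicator (not (inC u))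
    unit-weight u with inC u in outside
    ... | true = refl
    ... | false rewrite ==-false (not-root u outside) = refl

  others-lower : (n ^ 2 + othersIn ends r F) * (n ^ 2 + othersIn ends r F) ≤ℕ prize ends (φred n r) F
  others-lower = subst (λ s → s * s ≤ℕ prize ends (φred n r) F) weight-inside (prize-lower inC inC-linked)

  others-upper : prize ends (φred n r) F
    ≤ℕ (n ^ 2 + othersIn ends r F) * (n ^ 2 + othersIn ends r F) + n ^ 2
  others-upper = begin
    prize ends (φred n r) F
      ≤⟨ prize-upper inC inC-closed ⟩
    sumℕ I * sumℕ I + sumℕ O * sumℕ O
      ≤⟨ NP.+-monoʳ-≤ (sumℕ I * sumℕ I) (NP.*-mono-≤ weight-outside weight-outside) ⟩
    sumℕ I * sumℕ I + n * n
      ≡⟨ cong₂ (λ s t → s * s + t) weight-inside (sym (square n)) ⟩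
    (n ^ 2 + othersIn ends r F) * (n ^ 2 + othersIn ends r F) + n ^ 2 ∎
    where
    open NP.≤-Reasoning
    I O : Fin n → ℕ
    I = restrict inC (φred n r)
    O = restrict (λ u → not (inC u)) (φred n r)

-- the gap between consecutive squares: (N + a + 1)² > (N + a)² + N
square-gap : ∀ N a k → (N + k) * (N + k) ≤ℕ (N + a) * (N + a) + N → k ≤ℕ a
square-gap N a k bound with k NP.≤? a
... | yes k≤a = k≤a
... | no k≰a = ⊥-elim (NP.<-irrefl refl impossible)
  where
  open NP.≤-Reasoning
  expand : ∀ N a → (N + suc a) * (N + suc a) ≡ suc ((N + a) * (N + a) + N + (N + a + a))
  expand = solve-∀
  N+a<N+k : N + suc a ≤ℕ N + k
  N+a<N+k = NP.+-monoʳ-≤ N (NP.≰⇒> k≰a)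
  impossible : (N + a) * (N + a) + N <ℕ (N + a) * (N + a) + N
  impossible = begin-strict
    (N + a) * (N + a) + N                 ≤⟨ NP.m≤m+n _ (N + a + a) ⟩
    (N + a) * (N + a) + N + (N + a + a)   <⟨ NP.n<1+n _ ⟩
    suc ((N + a) * (N + a) + N + (N + a + a)) ≡⟨ expand N a ⟨
    (N + suc a) * (N + suc a)             ≤⟨ NP.*-mono-≤ N+a<N+k N+a<N+k ⟩
    (N + k) * (N + k)                     ≤⟨ bound ⟩
    (N + a) * (N + a) + N                 ∎

others-collect : ∀ {n m} (ends : Fin m → Fin n × Fin n) r F k → k ≤ℕ othersIn ends r F
  → (n ^ 2 + k) ^ 2 ≤ℕ prize ends (φred n r) F
others-collect {n} ends r F k k≤a = begin
  (n ^ 2 + k) ^ 2                 ≡⟨ square (n ^ 2 + k) ⟩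
  (n ^ 2 + k) * (n ^ 2 + k)       ≤⟨ NP.*-mono-≤ N+k≤N+a N+k≤N+a ⟩
  (n ^ 2 + othersIn ends r F) * (n ^ 2 + othersIn ends r F)
                                  ≤⟨ RootedPrize.others-lower ends r F ⟩
  prize ends (φred n r) F         ∎
  where
  open NP.≤-Reasoning
  N+k≤N+a : n ^ 2 + k ≤ℕ n ^ 2 + othersIn ends r F
  N+k≤N+a = NP.+-monoʳ-≤ (n ^ 2) k≤a

prize-forces-others : ∀ {n m} (ends : Fin m → Fin n × Fin n) r F k
  → (n ^ 2 + k) ^ 2 ≤ℕ prize ends (φred n r) F → k ≤ℕ othersIn ends r F
prize-forces-others {n} ends r F k S≤prize = square-gap (n ^ 2) (othersIn ends r F) k
  (NP.≤-trans (subst (_≤ℕ prize ends (φred n r) F) (square (n ^ 2 + k)) S≤prize)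
    (RootedPrize.others-upper ends r F))

sumℚ-mono : ∀ {m} (f g : Fin m → ℚ) → (∀ i → f i ≤ g i) → sumℚ f ≤ sumℚ g
sumℚ-mono {zero} f g f≤g = QP.≤-refl
sumℚ-mono {suc m} f g f≤g =
  QP.+-mono-≤ (f≤g zero) (sumℚ-mono (λ j → f (suc j)) (λ j → g (suc j)) (λ j → f≤g (suc j)))

cost-mono : ∀ {m} (c : Fin m → ℚ) → (∀ e → 0ℚ ≤ c e) → ∀ {G F} → G ⊆ F → cost c G ≤ cost c F
cost-mono c c≥0 {G} {F} G⊆F = sumℚ-mono _ _ λ e → edge-cost e (G e) (F e) (G⊆F e)
  where
  edge-cost : ∀ e g f → (g ≡ true → f ≡ true) → (if g then c e else 0ℚ) ≤ (if f then c e else 0ℚ)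
  edge-cost e true f g⇒f rewrite g⇒f refl = QP.≤-refl
  edge-cost e false true _ = c≥0 e
  edge-cost e false false _ = QP.≤-refl

theorem8 : (n m : ℕ) (ends : Fin m → Fin n × Fin n) (c : Fin m → ℚ)
    → (∀ e → 0ℚ ≤ c e) → (r : Fin n) (k : ℕ) → k ≤ℕ n ∸ 1
    → ((T : Fin m → Bool) → IsRootedTree ends r T → k ≤ℕ othersIn ends r T
         → Σ (Fin m → Bool) λ F → IsForest ends F × cost c F ≡ cost c T
             × (n ^ 2 + k) ^ 2 ≤ℕ prize ends (φred n r) F)
    × ((F : Fin m → Bool) → IsForest ends F → (n ^ 2 + k) ^ 2 ≤ℕ prize ends (φred n r) F
         → IsRootedTree ends r (compOf ends r F) × k ≤ℕ othersIn ends r (compOf ends r F))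
    × ((x : ℚ)
         → (Σ (Fin m → Bool) λ T → IsRootedTree ends r T × k ≤ℕ othersIn ends r T × cost c T ≤ x)
         ⇔ (Σ (Fin m → Bool) λ F → IsForest ends F
              × (n ^ 2 + k) ^ 2 ≤ℕ prize ends (φred n r) F × cost c F ≤ x))
theorem8 n m ends c c≥0 r k _ = tree⇒forest , forest⇒tree , optimum
  where
  open Walks.Component ends r using (compOf-⊆; compOf-rooted; compOf-others)

  tree⇒forest : (T : Fin m → Bool) → IsRootedTree ends r T → k ≤ℕ othersIn ends r T
    → Σ (Fin m → Bool) λ F → IsForest ends F × cost c F ≡ cost c T
        × (n ^ 2 + k) ^ 2 ≤ℕ prize ends (φred n r) F
  tree⇒forest T (T-forest , _) k≤a = T , T-forest , refl , others-collect ends r T k k≤a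

  forest⇒tree : (F : Fin m → Bool) → IsForest ends F → (n ^ 2 + k) ^ 2 ≤ℕ prize ends (φred n r) F
    → IsRootedTree ends r (compOf ends r F) × k ≤ℕ othersIn ends r (compOf ends r F)
  forest⇒tree F F-forest S≤prize =
    compOf-rooted F F-forest , NP.≤-trans (prize-forces-others ends r F k S≤prize) (compOf-others F)

  optimum : (x : ℚ)
    → (Σ (Fin m → Bool) λ T → IsRootedTree ends r T × k ≤ℕ othersIn ends r T × cost c T ≤ x)
    ⇔ (Σ (Fin m → Bool) λ F → IsForest ends F × (n ^ 2 + k) ^ 2 ≤ℕ prize ends (φred n r) F × cost c F ≤ x)
  optimum x = mk⇔
    (λ { (T , T-tree , k≤a , cost≤x) → T , proj₁ T-tree , others-collect ends r T k k≤a , cost≤x })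
    (λ { (F , F-forest , S≤prize , cost≤x) → let (tree , k≤a) = forest⇒tree F F-forest S≤prize in
      compOf ends r F , tree , k≤a , QP.≤-trans (cost-mono c c≥0 (compOf-⊆ F)) cost≤x })
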